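{- Let $G$ be a finite simple $d$-regular Vizing-class-2 graph that admits a spaced $(d+1)$-edge-coloring. Then $\eta_p'(G)\leq 2d=2\chi'(G)-2$.
   Context: A $d$-regular graph is Vizing-class-2 if its chromatic index $\chi'(G)$ equals $d+1$. For edges $e,e'$, $e'$ is 2-reachable from $e$ if there is a path of length two (three distinct vertices) from an endpoint of $e$ to an endpoint of $e'$. A spaced $(d+1)$-edge-coloring is a proper edge coloring $c:E(G)\to\{1,\dots,d+1\}$ such that whenever $c(e)=c(e')=d+1$ (including $e=e'$), $e'$ is not 2-reachable from $e$. For an edge $e$, $N'(e)$ is the set of edges other than $e$ sharing an endpoint with $e$. $\eta_p'(G)$ is the least $k$ such that there is a proper edge coloring $c:E(G)\to\{1,\dots,k\}$ with $\sum_{e\in N'(e_1)}c(e)\neq\sum_{e\in N'(e_2)}c(e)$ for every two edges $e_1,e_2$ sharing an endpoint. -}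

module Defs where

open import Data.Nat using (ℕ; zero; suc; _+_; _*_; _≤_; _<_)
open import Data.Fin using (Fin; _≟_)
open import Data.Bool using (Bool; true; false; if_then_else_; _∧_; not)
open import Data.Product using (_×_; Σ; ∃; ∃-syntax)
open import Data.Sum using (_⊎_)
open import Relation.Nullary using (¬_)
open import Relation.Nullary.Decidable using (⌊_⌋)
open import Relation.Binary.PropositionalEquality using (_≡_; _≢_)

sumFin : (n : ℕ) → (Fin n → ℕ) → ℕ
sumFin zero    f = 0
sumFin (suc n) f = f Fin.zero + sumFin n (λ i → f (Fin.suc i))

record Graph (n : ℕ) : Set where
  field
    adj    : Fin n → Fin n → Bool
    sym    : ∀ u v → adj u v ≡ adj v u
    irrefl : ∀ u → adj u u ≡ false

module _ {n : ℕ} (G : Graph n) where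
  open Graph G

  Adj : Fin n → Fin n → Set
  Adj u v = adj u v ≡ true

  degree : Fin n → ℕ
  degree u = sumFin n (λ v → if adj u v then 1 else 0)

  Regular : ℕ → Set
  Regular d = ∀ u → degree u ≡ d

  -- An edge coloring assigns a color to every edge {u,v}; it is represented
  -- by a function on ordered pairs, required to be symmetric on edges
  -- (values on non-adjacent pairs are irrelevant).
  IsProperEdgeColoring : ℕ → (Fin n → Fin n → ℕ) → Set
  IsProperEdgeColoring k c =
      (∀ u v → Adj u v → c u v ≡ c v u)
    × (∀ u v → Adj u v → 1 ≤ c u v × c u v ≤ k)
    × (∀ u v w → Adj u v → Adj u w → v ≢ w → c u v ≢ c u w)

  EdgeColorable : ℕ → Set
  EdgeColorable k = Σ (Fin n → Fin n → ℕ) (IsProperEdgeColoring k)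

  IsChromaticIndex : ℕ → Set
  IsChromaticIndex k = EdgeColorable k × (∀ j → j < k → ¬ EdgeColorable j)

  VizingClass2 : ℕ → Set
  VizingClass2 d = Regular d × IsChromaticIndex (suc d)

  TwoReachable : Fin n → Fin n → Fin n → Fin n → Set
  TwoReachable u v u' v' =
    ∃[ x ] ∃[ y ] ∃[ z ]
      ((x ≡ u ⊎ x ≡ v) × (z ≡ u' ⊎ z ≡ v')
      × Adj x y × Adj y z × x ≢ y × y ≢ z × x ≢ z)

  IsSpacedColoring : ℕ → (Fin n → Fin n → ℕ) → Set
  IsSpacedColoring d c =
      IsProperEdgeColoring (suc d) c
    × (∀ u v u' v' → Adj u v → Adj u' v' →
         c u v ≡ suc d → c u' v' ≡ suc d → ¬ TwoReachable u v u' v')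

  HasSpacedColoring : ℕ → Set
  HasSpacedColoring d = Σ (Fin n → Fin n → ℕ) (IsSpacedColoring d)

  -- Sum of colors over N'(uv): edges at u other than uv, plus edges at v
  -- other than uv (in a simple graph these two sets are disjoint).
  nbSum : (Fin n → Fin n → ℕ) → Fin n → Fin n → ℕ
  nbSum c u v =
      sumFin n (λ w → if adj u w ∧ not ⌊ w ≟ v ⌋ then c u w else 0)
    + sumFin n (λ w → if adj v w ∧ not ⌊ w ≟ u ⌋ then c v w else 0)

  IsNSDColoring : ℕ → (Fin n → Fin n → ℕ) → Set
  IsNSDColoring k c =
      IsProperEdgeColoring k c
    × (∀ u v w → Adj u v → Adj u w → v ≢ w → nbSum c u v ≢ nbSum c u w)

  -- η'_p(G) ≤ m : there is some k ≤ m admitting such a coloring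
  -- (equivalently, the least such k is at most m).
  EtaP≤ : ℕ → Set
  EtaP≤ m = ∃[ k ] (k ≤ m × Σ (Fin n → Fin n → ℕ) (IsNSDColoring k))

module Submission where

-- Recolour a spaced (d+1)-colouring c into c′ with c′ = 2c on colours 1..d and c′ = 1 on
-- colour d+1. For adjacent edges uv, uw the neighbour sums agree iff
-- S v + 2 c′(uw) = S w + 2 c′(uv), where S x is the sum of the c′-colours at x, and S x is
-- odd exactly when x meets an edge of colour d+1. If neither v nor w does, both see every
-- colour 1..d exactly once, so S v = S w and c′(uv) = c′(uw); if exactly one does, parity
-- separates the two sides; and both cannot, since the two (d+1)-coloured edges would be
-- 2-reachable along v u w.

open import Defs
open import Data.Nat using (ℕ; zero; suc; _+_; _*_; _∸_; _≤_; z≤n; s≤s; _≟_)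
open import Data.Nat.Properties
open import Algebra.Properties.CommutativeSemigroup +-commutativeSemigroup
  using (xy∙z≈xz∙y) renaming (interchange to +-interchange)
open import Data.Fin using (Fin) renaming (_≟_ to _≟F_)
import Data.Fin.Properties as Finₚ
open import Data.Bool using (Bool; true; false; if_then_else_; _∧_; not)
open import Data.Product using (_×_; _,_; Σ; proj₁; proj₂)
open import Data.Sum using (_⊎_; inj₁; inj₂)
open import Data.Empty using (⊥)
open import Relation.Nullary using (Dec; yes; no; contradiction)
open import Relation.Nullary.Decidable using (⌊_⌋)
open import Relation.Binary.PropositionalEquality

∧-true : ∀ {a b} → a ∧ b ≡ true → a ≡ true × b ≡ true
∧-true {true} {true} _ = refl , refl

⌊≟⌋-true : ∀ {x y : ℕ} → ⌊ x ≟ y ⌋ ≡ true → x ≡ y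
⌊≟⌋-true {x} {y} eq with x ≟ y
... | yes x≡y = x≡y

countFin : ∀ n → (Fin n → Bool) → ℕ
countFin n b = sumFin n (λ z → if b z then 1 else 0)

sumFin-cong : ∀ n {f g : Fin n → ℕ} → (∀ i → f i ≡ g i) → sumFin n f ≡ sumFin n g
sumFin-cong zero    eq = refl
sumFin-cong (suc n) eq = cong₂ _+_ (eq Fin.zero) (sumFin-cong n (λ i → eq (Fin.suc i)))

sumFin-0 : ∀ n → sumFin n (λ _ → 0) ≡ 0
sumFin-0 zero    = refl
sumFin-0 (suc n) = sumFin-0 n

sumFin-+ : ∀ n (f g : Fin n → ℕ) → sumFin n (λ i → f i + g i) ≡ sumFin n f + sumFin n g
sumFin-+ zero    f g = refl
sumFin-+ (suc n) f g =
  trans (cong (f Fin.zero + g Fin.zero +_) (sumFin-+ n (λ i → f (Fin.suc i)) (λ i → g (Fin.suc i))))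
        (+-interchange (f Fin.zero) (g Fin.zero) _ _)

sumFin-*ˡ : ∀ n m (g : Fin n → ℕ) → sumFin n (λ i → m * g i) ≡ m * sumFin n g
sumFin-*ˡ zero    m g = sym (*-zeroʳ m)
sumFin-*ˡ (suc n) m g =
  trans (cong (m * g Fin.zero +_) (sumFin-*ˡ n m (λ i → g (Fin.suc i))))
        (sym (*-distribˡ-+ m (g Fin.zero) _))

sumFin-if-const : ∀ n (b : Fin n → Bool) a → sumFin n (λ z → if b z then a else 0) ≡ a * countFin n b
sumFin-if-const n b a = trans (sumFin-cong n if-as-*) (sumFin-*ˡ n a _)
  where
  if-as-* : ∀ z → (if b z then a else 0) ≡ a * (if b z then 1 else 0)
  if-as-* z with b z
  ... | true  = sym (*-identityʳ a)
  ... | false = sym (*-zeroʳ a)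

term≤sumFin : ∀ n (g : Fin n → ℕ) i → g i ≤ sumFin n g
term≤sumFin (suc n) g Fin.zero    = m≤m+n _ _
term≤sumFin (suc n) g (Fin.suc i) = ≤-trans (term≤sumFin n _ i) (m≤n+m _ _)

sumFin-δ : ∀ n (g : Fin n → ℕ) y → sumFin n (λ z → if ⌊ z ≟F y ⌋ then g z else 0) ≡ g y
sumFin-δ (suc n) g Fin.zero    =
  trans (cong (g Fin.zero +_) (sumFin-0 n)) (+-identityʳ (g Fin.zero))
sumFin-δ (suc n) g (Fin.suc y) =
  trans (sumFin-cong n shift) (sumFin-δ n (λ z → g (Fin.suc z)) y)
  where
  shift : ∀ z → (if ⌊ Fin.suc z ≟F Fin.suc y ⌋ then g (Fin.suc z) else 0)
              ≡ (if ⌊ z ≟F y ⌋ then g (Fin.suc z) else 0)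
  shift z with z ≟F y
  ... | yes _ = refl
  ... | no  _ = refl

sumFin-remove : ∀ n (b : Fin n → Bool) (g : Fin n → ℕ) {y} → b y ≡ true →
  sumFin n (λ z → if b z then g z else 0)
    ≡ sumFin n (λ z → if b z ∧ not ⌊ z ≟F y ⌋ then g z else 0) + g y
sumFin-remove n b g {y} by = begin
  sumFin n (λ z → if b z then g z else 0)
    ≡⟨ sumFin-cong n split ⟩
  sumFin n (λ z → rest z + (if ⌊ z ≟F y ⌋ then g z else 0))
    ≡⟨ sumFin-+ n rest _ ⟩
  sumFin n rest + sumFin n (λ z → if ⌊ z ≟F y ⌋ then g z else 0)
    ≡⟨ cong (sumFin n rest +_) (sumFin-δ n g y) ⟩
  sumFin n rest + g y ∎
  where
  open ≡-Reasoning
  rest : Fin n → ℕ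
  rest z = if b z ∧ not ⌊ z ≟F y ⌋ then g z else 0
  split : ∀ z → (if b z then g z else 0) ≡ rest z + (if ⌊ z ≟F y ⌋ then g z else 0)
  split z with z ≟F y
  ... | yes refl rewrite by = refl
  ... | no  _ with b z
  ...   | true  = sym (+-identityʳ (g z))
  ...   | false = refl

countFin≤1 : ∀ n (b : Fin n → Bool) → (∀ x y → b x ≡ true → b y ≡ true → x ≡ y) →
  countFin n b ≤ 1
countFin≤1 zero    b unique = z≤n
countFin≤1 (suc n) b unique with b Fin.zero in b0
... | true  = ≤-reflexive (cong suc (trans (sumFin-cong n none) (sumFin-0 n)))
  where
  none : ∀ z → (if b (Fin.suc z) then 1 else 0) ≡ 0
  none z with b (Fin.suc z) in bz
  ... | true  = contradiction (unique _ _ b0 bz) Finₚ.0≢1+n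
  ... | false = refl
... | false = countFin≤1 n (λ z → b (Fin.suc z)) (λ x y p q → Finₚ.suc-injective (unique _ _ p q))

countFin≡1⇒∃ : ∀ n (b : Fin n → Bool) → countFin n b ≡ 1 → Σ (Fin n) (λ z → b z ≡ true)
countFin≡1⇒∃ (suc n) b eq with b Fin.zero in b0
... | true  = Fin.zero , b0
... | false with countFin≡1⇒∃ n (λ z → b (Fin.suc z)) eq
...   | z , bz = Fin.suc z , bz

sum1to : ℕ → (ℕ → ℕ) → ℕ
sum1to zero    g = 0
sum1to (suc k) g = sum1to k g + g (suc k)

sum1to-cong : ∀ k {f g : ℕ → ℕ} → (∀ {i} → 1 ≤ i → i ≤ k → f i ≡ g i) → sum1to k f ≡ sum1to k g
sum1to-cong zero    eq = refl
sum1to-cong (suc k) eq =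
  cong₂ _+_ (sum1to-cong k (λ 1≤i i≤k → eq 1≤i (m≤n⇒m≤1+n i≤k))) (eq (s≤s z≤n) ≤-refl)

sum1to-0 : ∀ k → sum1to k (λ _ → 0) ≡ 0
sum1to-0 zero    = refl
sum1to-0 (suc k) = trans (+-identityʳ _) (sum1to-0 k)

sum1to-+ : ∀ k (f g : ℕ → ℕ) → sum1to k (λ i → f i + g i) ≡ sum1to k f + sum1to k g
sum1to-+ zero    f g = refl
sum1to-+ (suc k) f g =
  trans (cong (_+ (f (suc k) + g (suc k))) (sum1to-+ k f g))
        (+-interchange (sum1to k f) (sum1to k g) _ _)

sum1to-*ˡ : ∀ k m (g : ℕ → ℕ) → sum1to k (λ i → m * g i) ≡ m * sum1to k g
sum1to-*ˡ zero    m g = sym (*-zeroʳ m)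
sum1to-*ˡ (suc k) m g =
  trans (cong (_+ m * g (suc k)) (sum1to-*ˡ k m g)) (sym (*-distribˡ-+ m (sum1to k g) _))

sumFin-sum1to-comm : ∀ n k (h : Fin n → ℕ → ℕ) →
  sumFin n (λ z → sum1to k (h z)) ≡ sum1to k (λ i → sumFin n (λ z → h z i))
sumFin-sum1to-comm zero    k h = sym (sum1to-0 k)
sumFin-sum1to-comm (suc n) k h =
  trans (cong (sum1to k (h Fin.zero) +_) (sumFin-sum1to-comm n k (λ z → h (Fin.suc z))))
        (sym (sum1to-+ k (h Fin.zero) _))

if-≢ : ∀ {x y : ℕ} a → x ≢ y → (if ⌊ x ≟ y ⌋ then a else 0) ≡ 0
if-≢ {x} {y} a x≢y with x ≟ y
... | yes x≡y = contradiction x≡y x≢y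
... | no  _   = refl

sum1to-δ : ∀ k (g : ℕ → ℕ) {x} → 1 ≤ x → x ≤ k →
  sum1to k (λ i → if ⌊ x ≟ i ⌋ then g i else 0) ≡ g x
sum1to-δ zero    g (s≤s _) ()
sum1to-δ (suc k) g {x} 1≤x x≤1+k with x ≟ suc k
... | yes refl =
  cong (_+ g (suc k))
    (trans (sum1to-cong k (λ _ i≤k → if-≢ _ (λ eq → <⇒≢ (s≤s i≤k) (sym eq)))) (sum1to-0 k))
... | no  x≢1+k =
  trans (+-identityʳ _) (sum1to-δ k g 1≤x (≤-pred (≤∧≢⇒< x≤1+k x≢1+k)))

sum1to-≤ : ∀ k (m : ℕ → ℕ) → (∀ i → m i ≤ 1) → sum1to k m ≤ k
sum1to-≤ zero    m m≤1 = z≤n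
sum1to-≤ (suc k) m m≤1 =
  ≤-trans (+-mono-≤ (sum1to-≤ k m m≤1) (m≤1 (suc k))) (≤-reflexive (+-comm k 1))

+-≡-suc-bounded : ∀ {a b k} → a ≤ k → b ≤ 1 → a + b ≡ suc k → a ≡ k × b ≡ 1
+-≡-suc-bounded {a} {0}           {k} a≤k _ eq =
  contradiction (subst (_≤ k) (trans (sym (+-identityʳ a)) eq) a≤k) (n≮n k)
+-≡-suc-bounded {a} {1}               _   _ eq = suc-injective (trans (+-comm 1 a) eq) , refl
+-≡-suc-bounded {b = suc (suc _)}     _   (s≤s ()) _

sum1to-saturated : ∀ k (m : ℕ → ℕ) → (∀ i → m i ≤ 1) → sum1to k m ≡ k →
  ∀ {i} → 1 ≤ i → i ≤ k → m i ≡ 1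
sum1to-saturated zero    m _   _    (s≤s _) ()
sum1to-saturated (suc k) m m≤1 sum≡ 1≤i i≤1+k
  with +-≡-suc-bounded (sum1to-≤ k m m≤1) (m≤1 (suc k)) sum≡ | m≤n⇒m<n∨m≡n i≤1+k
... | init≡k , _      | inj₁ i<1+k = sum1to-saturated k m m≤1 init≡k 1≤i (≤-pred i<1+k)
... | _      , last≡1 | inj₂ refl  = last≡1

module _ {n : ℕ} (G : Graph n) where
  open Graph G renaming (sym to adj-sym)

  Adj-sym : ∀ {u v} → Adj G u v → Adj G v u
  Adj-sym {u} {v} uv = trans (adj-sym v u) uv

  Adj⇒≢ : ∀ {u v} → Adj G u v → u ≢ v
  Adj⇒≢ {u} uv refl = contradiction (trans (sym (irrefl u)) uv) λ ()

  Adj⇒1≤degree : ∀ {u v} → Adj G u v → 1 ≤ degree G u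
  Adj⇒1≤degree {u} {v} uv =
    subst (λ b → (if b then 1 else 0) ≤ degree G u) uv (term≤sumFin n _ v)

  incSum : (Fin n → Fin n → ℕ) → Fin n → ℕ
  incSum c x = sumFin n (λ z → if adj x z then c x z else 0)

  nbSum-+-double : ∀ c {u v} → Adj G u v → c v u ≡ c u v →
    nbSum G c u v + 2 * c u v ≡ incSum c u + incSum c v
  nbSum-+-double c {u} {v} uv vu≡uv = sym (begin
    incSum c u + incSum c v
      ≡⟨ cong₂ _+_ (sumFin-remove n (adj u) (c u) uv) (sumFin-remove n (adj v) (c v) (Adj-sym uv)) ⟩
    (rest u v + c u v) + (rest v u + c v u)
      ≡⟨ cong (λ t → (rest u v + c u v) + (rest v u + t)) vu≡uv ⟩
    (rest u v + c u v) + (rest v u + c u v)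
      ≡⟨ +-interchange (rest u v) _ _ _ ⟩
    nbSum G c u v + (c u v + c u v)
      ≡⟨ cong (λ t → nbSum G c u v + (c u v + t)) (sym (+-identityʳ (c u v))) ⟩
    nbSum G c u v + 2 * c u v ∎)
    where
    open ≡-Reasoning
    rest : Fin n → Fin n → ℕ
    rest x y = sumFin n (λ z → if adj x z ∧ not ⌊ z ≟F y ⌋ then c x z else 0)

  nbSum-≡⇒ : ∀ c {u v w} → Adj G u v → Adj G u w → c v u ≡ c u v → c w u ≡ c u w →
    nbSum G c u v ≡ nbSum G c u w → incSum c v + 2 * c u w ≡ incSum c w + 2 * c u v
  nbSum-≡⇒ c {u} {v} {w} uv uw vu≡uv wu≡uw eq = +-cancelˡ-≡ (incSum c u) _ _ (begin
    incSum c u + (incSum c v + 2 * c u w)   ≡⟨ +-assoc (incSum c u) _ _ ⟨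
    incSum c u + incSum c v + 2 * c u w     ≡⟨ cong (_+ 2 * c u w) (nbSum-+-double c uv vu≡uv) ⟨
    nbSum G c u v + 2 * c u v + 2 * c u w   ≡⟨ cong (λ t → t + 2 * c u v + 2 * c u w) eq ⟩
    nbSum G c u w + 2 * c u v + 2 * c u w   ≡⟨ xy∙z≈xz∙y (nbSum G c u w) _ _ ⟩
    nbSum G c u w + 2 * c u w + 2 * c u v   ≡⟨ cong (_+ 2 * c u v) (nbSum-+-double c uw wu≡uw) ⟩
    incSum c u + incSum c w + 2 * c u v     ≡⟨ +-assoc (incSum c u) _ _ ⟩
    incSum c u + (incSum c w + 2 * c u v)   ∎)
    where open ≡-Reasoning

  colourCount : (Fin n → Fin n → ℕ) → Fin n → ℕ → ℕ
  colourCount c x i = countFin n (λ z → adj x z ∧ ⌊ c x z ≟ i ⌋)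

  module _ {k : ℕ} {c : Fin n → Fin n → ℕ} (proper : IsProperEdgeColoring G k c) where
    private
      inRange : ∀ u v → Adj G u v → 1 ≤ c u v × c u v ≤ k
      inRange = proj₁ (proj₂ proper)
      distinct : ∀ u v w → Adj G u v → Adj G u w → v ≢ w → c u v ≢ c u w
      distinct = proj₂ (proj₂ proper)

    incSum-by-colour : ∀ (F : ℕ → ℕ) x →
      incSum (λ x z → F (c x z)) x ≡ sum1to k (λ i → F i * colourCount c x i)
    incSum-by-colour F x = begin
      incSum (λ x z → F (c x z)) x
        ≡⟨ sumFin-cong n split-by-colour ⟩
      sumFin n (λ z → sum1to k (λ i → if adj x z ∧ ⌊ c x z ≟ i ⌋ then F i else 0))
        ≡⟨ sumFin-sum1to-comm n k _ ⟩
      sum1to k (λ i → sumFin n (λ z → if adj x z ∧ ⌊ c x z ≟ i ⌋ then F i else 0))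
        ≡⟨ sum1to-cong k (λ {i} _ _ → sumFin-if-const n _ (F i)) ⟩
      sum1to k (λ i → F i * colourCount c x i) ∎
      where
      open ≡-Reasoning
      split-by-colour : ∀ z → (if adj x z then F (c x z) else 0)
        ≡ sum1to k (λ i → if adj x z ∧ ⌊ c x z ≟ i ⌋ then F i else 0)
      split-by-colour z with adj x z in xz
      ... | true  = sym (sum1to-δ k F (proj₁ (inRange x z xz)) (proj₂ (inRange x z xz)))
      ... | false = sym (sum1to-0 k)

    degree-by-colour : ∀ x → degree G x ≡ sum1to k (colourCount c x)
    degree-by-colour x =
      trans (incSum-by-colour (λ _ → 1) x) (sum1to-cong k (λ _ _ → *-identityˡ _))

    colourCount≤1 : ∀ x i → colourCount c x i ≤ 1
    colourCount≤1 x i = countFin≤1 n _ unique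
      where
      unique : ∀ z z' → (adj x z ∧ ⌊ c x z ≟ i ⌋) ≡ true → (adj x z' ∧ ⌊ c x z' ≟ i ⌋) ≡ true → z ≡ z'
      unique z z' p q with ∧-true p | ∧-true q | z ≟F z'
      ... | _ | _ | yes z≡z' = z≡z'
      ... | xz , cz | xz' , cz' | no z≢z' =
        contradiction (trans (⌊≟⌋-true cz) (sym (⌊≟⌋-true cz'))) (distinct x z z' xz xz' z≢z')

    colourCount≡1⇒∃ : ∀ {x i} → colourCount c x i ≡ 1 → Σ (Fin n) (λ z → Adj G x z × c x z ≡ i)
    colourCount≡1⇒∃ count≡1 with countFin≡1⇒∃ n _ count≡1
    ... | z , p = z , proj₁ (∧-true p) , ⌊≟⌋-true (proj₂ (∧-true p))

  top-free⇒saturated : ∀ {d c} → Regular G d → IsProperEdgeColoring G (suc d) c →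
    ∀ {x} → colourCount c x (suc d) ≡ 0 → ∀ {i} → 1 ≤ i → i ≤ d → colourCount c x i ≡ 1
  top-free⇒saturated {d} {c} regular proper {x} free =
    sum1to-saturated d (colourCount c x) (colourCount≤1 proper x) (begin
      sum1to d (colourCount c x)                        ≡⟨ +-identityʳ _ ⟨
      sum1to d (colourCount c x) + 0                    ≡⟨ cong (sum1to d (colourCount c x) +_) free ⟨
      sum1to d (colourCount c x) + colourCount c x (suc d) ≡⟨ degree-by-colour proper x ⟨
      degree G x                                        ≡⟨ regular x ⟩
      d                                                 ∎)
    where open ≡-Reasoning

recolour : ℕ → ℕ → ℕ
recolour k i = if ⌊ i ≟ k ⌋ then 1 else 2 * i

recolour-top : ∀ k → recolour k k ≡ 1
recolour-top k with k ≟ k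
... | yes _   = refl
... | no k≢k  = contradiction refl k≢k

recolour-other : ∀ {k i} → i ≢ k → recolour k i ≡ 2 * i
recolour-other {k} {i} i≢k with i ≟ k
... | yes i≡k = contradiction i≡k i≢k
... | no  _   = refl

recolour-injective : ∀ k {i j} → recolour k i ≡ recolour k j → i ≡ j
recolour-injective k {i} {j} eq = by-cases (i ≟ k) (j ≟ k)
  where
  by-cases : Dec (i ≡ k) → Dec (j ≡ k) → i ≡ j
  by-cases (yes refl) (yes refl) = refl
  by-cases (yes refl) (no  j≢k)  =
    contradiction (trans (sym (recolour-other j≢k)) (trans (sym eq) (recolour-top k))) (even≢odd j 0)
  by-cases (no  i≢k)  (yes refl) =
    contradiction (trans (sym (recolour-other i≢k)) (trans eq (recolour-top k))) (even≢odd i 0)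
  by-cases (no  i≢k)  (no  j≢k)  =
    *-cancelˡ-≡ i j 2 (trans (sym (recolour-other i≢k)) (trans eq (recolour-other j≢k)))

recolour-range : ∀ {d i} → 1 ≤ d → 1 ≤ i → i ≤ suc d →
  1 ≤ recolour (suc d) i × recolour (suc d) i ≤ 2 * d
recolour-range {d} {i} 1≤d 1≤i i≤1+d with i ≟ suc d
... | yes refl = ≤-refl , ≤-trans 1≤d (m≤m+n d _)
... | no  i≢1+d =
  ≤-trans 1≤i (m≤m+n i _) , *-monoʳ-≤ 2 (≤-pred (≤∧≢⇒< i≤1+d i≢1+d))

odd+even≢even+even : ∀ p q r s → suc (2 * p) + 2 * q ≢ 2 * r + 2 * s
odd+even≢even+even p q r s eq = even≢odd (r + s) (p + q) (begin
  2 * (r + s)           ≡⟨ *-distribˡ-+ 2 r s ⟩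
  2 * r + 2 * s         ≡⟨ eq ⟨
  suc (2 * p + 2 * q)   ≡⟨ cong suc (*-distribˡ-+ 2 p q) ⟨
  suc (2 * (p + q))     ∎)
  where open ≡-Reasoning

module SpacedRecolouring {n d : ℕ} (G : Graph n) {c : Fin n → Fin n → ℕ}
  (regular : Regular G d) (spaced : IsSpacedColoring G d c) where

  private
    proper : IsProperEdgeColoring G (suc d) c
    proper = proj₁ spaced
    symmetric : ∀ u v → Adj G u v → c u v ≡ c v u
    symmetric = proj₁ proper
    inRange : ∀ u v → Adj G u v → 1 ≤ c u v × c u v ≤ suc d
    inRange = proj₁ (proj₂ proper)
    distinct : ∀ u v w → Adj G u v → Adj G u w → v ≢ w → c u v ≢ c u w
    distinct = proj₂ (proj₂ proper)
    topCount : Fin n → ℕ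
    topCount x = colourCount G c x (suc d)

  recoloured : Fin n → Fin n → ℕ
  recoloured x y = recolour (suc d) (c x y)

  recoloured-proper : IsProperEdgeColoring G (2 * d) recoloured
  recoloured-proper =
      (λ u v uv → cong (recolour (suc d)) (symmetric u v uv))
    , (λ u v uv → recolour-range (subst (1 ≤_) (regular u) (Adj⇒1≤degree G uv))
                                 (proj₁ (inRange u v uv)) (proj₂ (inRange u v uv)))
    , (λ u v w uv uw v≢w eq → distinct u v w uv uw v≢w (recolour-injective (suc d) eq))

  lowSum : Fin n → ℕ
  lowSum x = sum1to d (λ i → i * colourCount G c x i)

  incSum-recoloured : ∀ x → incSum G recoloured x ≡ 2 * lowSum x + topCount x
  incSum-recoloured x =
    trans (incSum-by-colour G proper (recolour (suc d)) x) (cong₂ _+_ low top)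
    where
    low : sum1to d (λ i → recolour (suc d) i * colourCount G c x i) ≡ 2 * lowSum x
    low = trans (sum1to-cong d (λ {i} _ i≤d →
                  trans (cong (_* colourCount G c x i) (recolour-other (<⇒≢ (s≤s i≤d))))
                        (*-assoc 2 i _)))
                (sum1to-*ˡ d 2 _)
    top : recolour (suc d) (suc d) * topCount x ≡ topCount x
    top = trans (cong (_* topCount x) (recolour-top (suc d))) (*-identityˡ _)

  incSum-top-free : ∀ {x} → topCount x ≡ 0 → incSum G recoloured x ≡ 2 * sum1to d (λ i → i)
  incSum-top-free {x} free = begin
    incSum G recoloured x      ≡⟨ incSum-recoloured x ⟩
    2 * lowSum x + topCount x  ≡⟨ cong (2 * lowSum x +_) free ⟩
    2 * lowSum x + 0           ≡⟨ +-identityʳ _ ⟩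
    2 * lowSum x               ≡⟨ cong (2 *_) (sum1to-cong d saturated) ⟩
    2 * sum1to d (λ i → i)     ∎
    where
    open ≡-Reasoning
    saturated : ∀ {i} → 1 ≤ i → i ≤ d → i * colourCount G c x i ≡ i
    saturated {i} 1≤i i≤d =
      trans (cong (i *_) (top-free⇒saturated G regular proper free 1≤i i≤d)) (*-identityʳ _)

  incSum-top-used : ∀ {x} → topCount x ≡ 1 → incSum G recoloured x ≡ suc (2 * lowSum x)
  incSum-top-used {x} used =
    trans (incSum-recoloured x) (trans (cong (2 * lowSum x +_) used) (+-comm _ 1))

  recoloured-distinguishes : ∀ u v w → Adj G u v → Adj G u w → v ≢ w →
    nbSum G recoloured u v ≢ nbSum G recoloured u w
  recoloured-distinguishes u v w uv uw v≢w eq =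
    by-top-counts (n≤1⇒n≡0∨n≡1 (colourCount≤1 G proper v (suc d)))
                  (n≤1⇒n≡0∨n≡1 (colourCount≤1 G proper w (suc d)))
    where
    a b : ℕ
    a = recoloured u v
    b = recoloured u w
    balanced : ∀ {p q} → incSum G recoloured v ≡ p → incSum G recoloured w ≡ q →
      p + 2 * b ≡ q + 2 * a
    balanced Sv≡p Sw≡q = subst₂ (λ Sv Sw → Sv + 2 * b ≡ Sw + 2 * a) Sv≡p Sw≡q
      (nbSum-≡⇒ G recoloured uv uw
        (cong (recolour (suc d)) (symmetric v u (Adj-sym G uv)))
        (cong (recolour (suc d)) (symmetric w u (Adj-sym G uw))) eq)
    by-top-counts : topCount v ≡ 0 ⊎ topCount v ≡ 1 → topCount w ≡ 0 ⊎ topCount w ≡ 1 → ⊥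
    by-top-counts (inj₁ v-free) (inj₁ w-free) =
      distinct u v w uv uw v≢w (sym (recolour-injective (suc d) (*-cancelˡ-≡ b a 2
        (+-cancelˡ-≡ (2 * sum1to d (λ i → i)) _ _
          (balanced (incSum-top-free v-free) (incSum-top-free w-free))))))
    by-top-counts (inj₂ v-used) (inj₁ w-free) =
      odd+even≢even+even (lowSum v) b (sum1to d (λ i → i)) a
        (balanced (incSum-top-used v-used) (incSum-top-free w-free))
    by-top-counts (inj₁ v-free) (inj₂ w-used) =
      odd+even≢even+even (lowSum w) a (sum1to d (λ i → i)) b
        (sym (balanced (incSum-top-free v-free) (incSum-top-used w-used)))
    by-top-counts (inj₂ v-used) (inj₂ w-used)
      with colourCount≡1⇒∃ G proper v-used | colourCount≡1⇒∃ G proper w-used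
    ... | z , vz , vz-top | z' , wz' , wz'-top =
      proj₂ spaced v z w z' vz wz' vz-top wz'-top
        (v , u , w , inj₁ refl , inj₁ refl , Adj-sym G uv , uw ,
         Adj⇒≢ G (Adj-sym G uv) , Adj⇒≢ G uw , v≢w)

theorem2p9 : (n d : ℕ) (G : Graph n) →
    VizingClass2 G d → HasSpacedColoring G d →
    EtaP≤ G (2 * d) × EtaP≤ G (2 * suc d ∸ 2)
theorem2p9 n d G (regular , _) (c , spaced) =
  η≤2d , subst (EtaP≤ G) (sym 2[1+d]∸2≡2d) η≤2d
  where
  open SpacedRecolouring G regular spaced
  η≤2d : EtaP≤ G (2 * d)
  η≤2d = 2 * d , ≤-refl , recoloured , recoloured-proper , recoloured-distinguishes
  2[1+d]∸2≡2d : 2 * suc d ∸ 2 ≡ 2 * d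
  2[1+d]∸2≡2d = trans (cong (_∸ 2) (*-suc 2 d)) (m+n∸m≡n 2 (2 * d))
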